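{- Let $\mathsf{Var}$ be a set and let $\mathsf{Tm}$, map expressions, $\mathsf{Nf}$, $\mathsf{emb}$ and $\mathsf{nf}$ be as defined in the context. For every $A \in \mathsf{Tm}$, every $N \in \mathsf{Nf}$ and every map expression $f : A \Rightarrow \mathsf{emb}\,N$, we have $\mathsf{nf}\,A = N$.
   Context: Fix a set $\mathsf{Var}$. The set $\mathsf{Tm}$ of object expressions is defined inductively: for $X \in \mathsf{Var}$, $\mathsf{v}\,X \in \mathsf{Tm}$; $\mathsf{I} \in \mathsf{Tm}$; if $A, B \in \mathsf{Tm}$ then $A \otimes B \in \mathsf{Tm}$. For $A, B \in \mathsf{Tm}$, the set $A \Rightarrow B$ of map expressions is defined inductively by: $\mathsf{id} : A \Rightarrow A$; if $f : B \Rightarrow C$ and $g : A \Rightarrow B$ then $f \circ g : A \Rightarrow C$; if $f : A \Rightarrow C$ and $g : B \Rightarrow D$ then $f \otimes g : A \otimes B \Rightarrow C \otimes D$; $\lambda : \mathsf{I} \otimes A \Rightarrow A$; $\rho : A \Rightarrow A \otimes \mathsf{I}$; $\alpha : (A \otimes B) \otimes C \Rightarrow A \otimes (B \otimes C)$. The set $\mathsf{Nf}$ is defined inductively: $\mathsf{J} \in \mathsf{Nf}$; if $X \in \mathsf{Var}$, $N \in \mathsf{Nf}$ then $X \mathbin{`\otimes} N \in \mathsf{Nf}$. $\mathsf{emb} : \mathsf{Nf} \to \mathsf{Tm}$ is given by $\mathsf{emb}\,\mathsf{J} = \mathsf{I}$, $\mathsf{emb}(X \mathbin{`\otimes} N)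 = \mathsf{v}\,X \otimes \mathsf{emb}\,N$. Define $\mathsf{nf}'_{\mathsf{v}X}\,N = X \mathbin{`\otimes} N$, $\mathsf{nf}'_{\mathsf{I}}\,N = N$, $\mathsf{nf}'_{A\otimes B}\,N = \mathsf{nf}'_A(\mathsf{nf}'_B\,N)$, and $\mathsf{nf}\,A = \mathsf{nf}'_A\,\mathsf{J}$. -}

module Defs where

open import Level using (Level)
open import Relation.Binary.PropositionalEquality using (_≡_)

module Syntax {ℓ : Level} (Var : Set ℓ) where

  infixl 30 _⊗_
  data Tm : Set ℓ where
    `_ : Var → Tm
    I : Tm
    _⊗_ : Tm → Tm → Tm

  infix 15 _⇒_
  infixl 20 _∘_
  infixl 30 _⊗₁_
  -- map expressions (note: ρ : A ⇒ A ⊗ I, as in the paper)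
  data _⇒_ : Tm → Tm → Set ℓ where
    id : {A : Tm} → A ⇒ A
    _∘_ : {A B C : Tm} → B ⇒ C → A ⇒ B → A ⇒ C
    _⊗₁_ : {A B C D : Tm} → A ⇒ C → B ⇒ D → A ⊗ B ⇒ C ⊗ D
    λ⇒ : {A : Tm} → I ⊗ A ⇒ A
    ρ⇒ : {A : Tm} → A ⇒ A ⊗ I
    α⇒ : {A B C : Tm} → (A ⊗ B) ⊗ C ⇒ A ⊗ (B ⊗ C)

  infixr 30 _`⊗_
  data Nf : Set ℓ where
    J : Nf
    _`⊗_ : Var → Nf → Nf

  emb : Nf → Tm
  emb J = I
  emb (X `⊗ N) = (` X) ⊗ emb N

  nf' : Tm → Nf → Nf
  nf' (` X) N = X `⊗ N
  nf' I N = N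
  nf' (A ⊗ B) N = nf' A (nf' B N)

  nf : Tm → Nf
  nf A = nf' A J

module Submission where

-- The evaluation  nf' A : Nf → Nf  ("prepend the variables of A, in order,
-- skipping units") is the same function for the source and the target of
-- every map expression: each generator (λ, ρ, α) relates objects with
-- definitionally equal evaluations, and the equation is preserved by
-- composition and by ⊗ on maps.  Taking the initial accumulator J gives
-- nf A ≡ nf B whenever A ⇒ B.  Since a normal form N is recovered from its
-- embedding, nf (emb N) ≡ N, any map A ⇒ emb N forces nf A ≡ N.

open import Defs
open import Level using (Level)
open import Relation.Binary.PropositionalEquality
  using (_≡_; refl; trans; cong; module ≡-Reasoning)

module Invariance {ℓ : Level} (Var : Set ℓ) where
  open Syntax Var

  nf'-invariant : {A B : Tm} → A ⇒ B → (M : Nf) → nf' A M ≡ nf' B M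
  nf'-invariant id M = refl
  nf'-invariant (f ∘ g) M = trans (nf'-invariant g M) (nf'-invariant f M)
  nf'-invariant (_⊗₁_ {A} {B} {C} {D} f g) M = begin
    nf' A (nf' B M)  ≡⟨ cong (nf' A) (nf'-invariant g M) ⟩
    nf' A (nf' D M)  ≡⟨ nf'-invariant f (nf' D M) ⟩
    nf' C (nf' D M)  ∎
    where open ≡-Reasoning
  nf'-invariant λ⇒ M = refl
  nf'-invariant ρ⇒ M = refl
  nf'-invariant α⇒ M = refl

  nf-emb : (N : Nf) → nf (emb N) ≡ N
  nf-emb J = refl
  nf-emb (X `⊗ N) = cong (X `⊗_) (nf-emb N)

proposition3 : {ℓ : Level} (Var : Set ℓ) → let open Syntax Var in
    (A : Tm) (N : Nf) (f : A ⇒ emb N) → nf A ≡ N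
proposition3 Var A N f = begin
  nf A        ≡⟨ nf'-invariant f J ⟩
  nf (emb N)  ≡⟨ nf-emb N ⟩
  N           ∎
  where
    open Syntax Var
    open Invariance Var
    open ≡-Reasoning
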